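{- Let $Q$ be a selective cost dioid. Let $\mathsf{b},\mathsf{ba}$ be countable index sets, and let $M\in Q^{\mathsf{b}\times\mathsf{b}}$, $M^\sharp\in Q^{\mathsf{ba}\times\mathsf{ba}}$. Let $\alpha_1\in Q^{\mathsf{ba}\times\mathsf{b}}$ have entries in $\{\bot,e\}$, and assume $\alpha_1\otimes M\le M^\sharp\otimes\alpha_1$ entrywise. Let $\sigma\in\mathsf{b}$ and $k\ge1$ with $(M^k)_{\sigma\sigma}\ne\bot$. Suppose $\{a\in\mathsf{ba}\mid(\alpha_1)_{a\sigma}=e\}=\{\sigma^\sharp_1,\dots,\sigma^\sharp_s\}$ with $s\ge1$ (pairwise distinct elements). Then there exist $1\le j\le s$ and $1\le r\le s$ such that $$\sqrt[k]{(M^k)_{\sigma\sigma}}\le\sqrt[kr]{((M^\sharp)^{kr})_{\sigma^\sharp_j\sigma^\sharp_j}}.$$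
   Context: A commutative dioid $(Q,\oplus,\otimes)$ is defined by the following conditions. $\otimes$ is associative and commutative with neutral element $e$. $\oplus$ is associative and commutative with neutral element $\bot$. $\otimes$ distributes over $\oplus$, and $\bot$ is absorbing. The relation $a\le b\iff\exists c,\ a\oplus c=b$ is a partial order. A cost dioid is a commutative dioid with the following further properties. It is idempotent. It is complete: arbitrary sums exist and $\otimes$ distributes over them. Every equation $X^n=q$ ($n\ge1$) has a unique solution $\sqrt[n]{q}$. The $n$-th power preserves arbitrary sums. $Q$ is selective if $a\oplus b\in\{a,b\}$ for all $a,b$. Matrix product: $(A\otimes B)_{ij}=\bigoplus_kA_{ik}\otimes B_{kj}$. Matrices are compared entrywise. -}

module Defs where

open import Level using (0ℓ)
open import Data.Nat using (ℕ; zero; suc; _≤_)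
open import Data.Product using (Σ; ∃; _×_; _,_)
open import Data.Sum using (_⊎_)
open import Relation.Binary.PropositionalEquality using (_≡_)
open import Relation.Nullary using (Dec; yes; no)
open import Function.Definitions using (Injective)

powWith : {Q : Set} → (Q → Q → Q) → Q → ℕ → Q → Q
powWith _⊗_ e zero    x = e
powWith _⊗_ e (suc n) x = x ⊗ powWith _⊗_ e n x

record CostDioid : Set₁ where
  infixl 6 _⊕_
  infixl 7 _⊗_
  infix 4 _≤Q_
  field
    Q   : Set
    _⊕_ : Q → Q → Q
    _⊗_ : Q → Q → Q
    ⊥Q  : Q
    e   : Q
    ⊗-assoc : ∀ a b c → (a ⊗ b) ⊗ c ≡ a ⊗ (b ⊗ c)
    ⊗-comm  : ∀ a b → a ⊗ b ≡ b ⊗ a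
    ⊗-idˡ   : ∀ a → e ⊗ a ≡ a
    ⊕-assoc : ∀ a b c → (a ⊕ b) ⊕ c ≡ a ⊕ (b ⊕ c)
    ⊕-comm  : ∀ a b → a ⊕ b ≡ b ⊕ a
    ⊕-idˡ   : ∀ a → ⊥Q ⊕ a ≡ a
    distribˡ : ∀ a b c → a ⊗ (b ⊕ c) ≡ (a ⊗ b) ⊕ (a ⊗ c)
    ⊥-absorbˡ : ∀ a → ⊥Q ⊗ a ≡ ⊥Q

  _≤Q_ : Q → Q → Set
  a ≤Q b = ∃ λ c → a ⊕ c ≡ b

  pow : ℕ → Q → Q
  pow = powWith _⊗_ e

  field
    ≤-antisym : ∀ a b → a ≤Q b → b ≤Q a → a ≡ b
    ⊕-idem : ∀ a → a ⊕ a ≡ a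
    ⨁ : {I : Set} → (I → Q) → Q
    ⨁-upper : {I : Set} (f : I → Q) (i : I) → f i ≤Q ⨁ f
    ⨁-least : {I : Set} (f : I → Q) (b : Q) → (∀ i → f i ≤Q b) → ⨁ f ≤Q b
    ⨁-distrib : {I : Set} (a : Q) (f : I → Q) → a ⊗ ⨁ f ≡ ⨁ (λ i → a ⊗ f i)
    root : ℕ → Q → Q
    root-pow : ∀ n q → 1 ≤ n → pow n (root n q) ≡ q
    root-unique : ∀ n x q → 1 ≤ n → pow n x ≡ q → x ≡ root n q
    pow-⨁ : ∀ n {I : Set} (f : I → Q) → 1 ≤ n → pow n (⨁ f) ≡ ⨁ (λ i → pow n (f i))

Selective : CostDioid → Set
Selective D = ∀ a b → (a ⊕ b ≡ a) ⊎ (a ⊕ b ≡ b)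
  where open CostDioid D

record Countable (I : Set) : Set where
  field
    enc     : I → ℕ
    enc-inj : Injective _≡_ _≡_ enc

open import Data.Nat.Properties using (_≟_)

countable-dec : {I : Set} → Countable I → (x y : I) → Dec (x ≡ y)
countable-dec C x y with Countable.enc C x ≟ Countable.enc C y
... | yes p = yes (Countable.enc-inj C p)
... | no ¬p = no (λ q → ¬p (Relation.Binary.PropositionalEquality.cong (Countable.enc C) q))

module Matrices (D : CostDioid) where
  open CostDioid D

  Mat : Set → Set → Set
  Mat I J = I → J → Q

  _⊗M_ : {I J K : Set} → Mat I K → Mat K J → Mat I J
  (A ⊗M B) i j = ⨁ (λ k → A i k ⊗ B k j)

  _≤M_ : {I J : Set} → Mat I J → Mat I J → Set
  A ≤M B = ∀ i j → A i j ≤Q B i j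

  idM : {I : Set} → Countable I → Mat I I
  idM C i j with countable-dec C i j
  ... | yes _ = e
  ... | no  _ = ⊥Q

  powM : {I : Set} → Countable I → ℕ → Mat I I → Mat I I
  powM C zero    M = idM C
  powM C (suc n) M = M ⊗M powM C n M

-- The simulation α₁ ⊗ M ≤ M♯ ⊗ α₁ lifts to all powers, so the closed walk of weight
-- q = (M^k)σσ is dominated, from every σ♯ⱼ, by a k-step M♯-walk σ♯ⱼ → σ♯ⱼ' with the
-- best end point j' (selectivity makes the sum over the lifts a maximum). Following
-- best end points from σ♯₁ must revisit some σ♯ⱼ after r ≤ s rounds, which gives
-- q^r ≤ ((M♯)^{kr})_{σ♯ⱼσ♯ⱼ}; taking kr-th roots yields the claim.
module Submission where

open import Defs
open import Data.Nat using (ℕ; zero; suc; _≤_; _<_; _+_; _*_; _∸_)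
import Data.Nat.Properties as ℕ
open import Data.Nat.GeneralisedArithmetic using (iterate)
open import Data.Fin using (Fin; toℕ) renaming (zero to fzero; suc to fsuc)
import Data.Fin.Properties as Fin
open import Data.Product using (∃; _×_; _,_; proj₁; proj₂)
open import Data.Sum using (_⊎_; inj₁; inj₂)
open import Relation.Nullary using (¬_; yes; no)
open import Data.Empty using (⊥-elim)
open import Relation.Binary.Bundles using (Preorder)
open import Relation.Binary.PropositionalEquality
  using (_≡_; refl; sym; trans; cong; cong₂; subst; isEquivalence; module ≡-Reasoning)
import Relation.Binary.Reasoning.Preorder as PreorderReasoning
open import Function.Definitions using (Injective)

iterate-+ : ∀ {A : Set} (f : A → A) x m n →
            iterate f x (m + n) ≡ iterate f (iterate f x m) n
iterate-+ f x zero    n = refl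
iterate-+ f x (suc m) n = iterate-+ f (f x) m n

iterate-cycle : ∀ {A : Set} (f : A → A) x {m n} → m < n → iterate f x m ≡ iterate f x n →
                iterate f (iterate f x m) (n ∸ m) ≡ iterate f x m
iterate-cycle f x {m} {n} m<n fᵐx≡fⁿx = begin
  iterate f (iterate f x m) (n ∸ m) ≡⟨ iterate-+ f x m (n ∸ m) ⟨
  iterate f x (m + (n ∸ m))         ≡⟨ cong (iterate f x) (ℕ.m+[n∸m]≡n (ℕ.<⇒≤ m<n)) ⟩
  iterate f x n                     ≡⟨ fᵐx≡fⁿx ⟨
  iterate f x m                     ∎
  where open ≡-Reasoning

periodic-point : ∀ {n} (f : Fin (suc n) → Fin (suc n)) →
                 ∃ λ j → ∃ λ r → 1 ≤ r × r ≤ suc n × iterate f j r ≡ j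
periodic-point {n} f =
  let (i , i′ , i<i′ , same) = Fin.pigeonhole ℕ.≤-refl orbit in
  iterate f fzero (toℕ i) , toℕ i′ ∸ toℕ i , ℕ.m<n⇒0<n∸m i<i′ ,
  ℕ.≤-trans (ℕ.m∸n≤m (toℕ i′) (toℕ i)) (ℕ.≤-pred (Fin.toℕ<n i′)) ,
  iterate-cycle f fzero i<i′ same
  where
  orbit : Fin (suc (suc n)) → Fin (suc n)
  orbit i = iterate f fzero (toℕ i)

module CostDioidProperties (D : CostDioid) where
  open CostDioid D
  open Matrices D

  ≤-reflexive : ∀ {a b} → a ≡ b → a ≤Q b
  ≤-reflexive {a} refl = a , ⊕-idem a

  ≤-refl : ∀ {a} → a ≤Q a
  ≤-refl = ≤-reflexive refl

  ≤-trans : ∀ {a b c} → a ≤Q b → b ≤Q c → a ≤Q c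
  ≤-trans {a} (c₁ , p) (c₂ , q) =
    c₁ ⊕ c₂ , trans (sym (⊕-assoc a c₁ c₂)) (trans (cong (_⊕ c₂) p) q)

  ≤-preorder : Preorder _ _ _
  ≤-preorder = record
    { isPreorder = record
      { isEquivalence = isEquivalence ; reflexive = ≤-reflexive ; trans = ≤-trans } }

  module ≤-Reasoning = PreorderReasoning ≤-preorder

  ⊥-least : ∀ a → ⊥Q ≤Q a
  ⊥-least a = a , ⊕-idˡ a

  ⊗-idʳ : ∀ a → a ⊗ e ≡ a
  ⊗-idʳ a = trans (⊗-comm a e) (⊗-idˡ a)

  ⊥-absorbʳ : ∀ a → a ⊗ ⊥Q ≡ ⊥Q
  ⊥-absorbʳ a = trans (⊗-comm a ⊥Q) (⊥-absorbˡ a)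

  distribʳ : ∀ a b c → (b ⊕ c) ⊗ a ≡ (b ⊗ a) ⊕ (c ⊗ a)
  distribʳ a b c = begin
    (b ⊕ c) ⊗ a       ≡⟨ ⊗-comm (b ⊕ c) a ⟩
    a ⊗ (b ⊕ c)       ≡⟨ distribˡ a b c ⟩
    (a ⊗ b) ⊕ (a ⊗ c) ≡⟨ cong₂ _⊕_ (⊗-comm a b) (⊗-comm a c) ⟩
    (b ⊗ a) ⊕ (c ⊗ a) ∎
    where open ≡-Reasoning

  ⊗-monoˡ : ∀ {a b} c → a ≤Q b → a ⊗ c ≤Q b ⊗ c
  ⊗-monoˡ {a} c (d , a⊕d≡b) = d ⊗ c , trans (sym (distribʳ c a d)) (cong (_⊗ c) a⊕d≡b)

  ⊗-monoʳ : ∀ {a b} c → a ≤Q b → c ⊗ a ≤Q c ⊗ b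
  ⊗-monoʳ {a} {b} c a≤b = begin
    c ⊗ a ≡⟨ ⊗-comm c a ⟩
    a ⊗ c ≲⟨ ⊗-monoˡ c a≤b ⟩
    b ⊗ c ≡⟨ ⊗-comm b c ⟩
    c ⊗ b ∎
    where open ≤-Reasoning

  ⊗-mono : ∀ {a b c d} → a ≤Q b → c ≤Q d → a ⊗ c ≤Q b ⊗ d
  ⊗-mono {b = b} {c = c} a≤b c≤d = ≤-trans (⊗-monoˡ c a≤b) (⊗-monoʳ b c≤d)

  ⨁-mono : ∀ {I : Set} {f g : I → Q} → (∀ i → f i ≤Q g i) → ⨁ f ≤Q ⨁ g
  ⨁-mono {f = f} {g} f≤g = ⨁-least f (⨁ g) (λ i → ≤-trans (f≤g i) (⨁-upper g i))

  ⨁-distribʳ-≤ : ∀ {I : Set} (f : I → Q) a → ⨁ f ⊗ a ≤Q ⨁ (λ i → f i ⊗ a)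
  ⨁-distribʳ-≤ f a = begin
    ⨁ f ⊗ a               ≡⟨ ⊗-comm (⨁ f) a ⟩
    a ⊗ ⨁ f               ≡⟨ ⨁-distrib a f ⟩
    ⨁ (λ i → a ⊗ f i)     ≲⟨ ⨁-mono (λ i → ≤-reflexive (⊗-comm a (f i))) ⟩
    ⨁ (λ i → f i ⊗ a)     ∎
    where open ≤-Reasoning

  pow-+ : ∀ m n x → pow (m + n) x ≡ pow m x ⊗ pow n x
  pow-+ zero    n x = sym (⊗-idˡ (pow n x))
  pow-+ (suc m) n x = trans (cong (x ⊗_) (pow-+ m n x)) (sym (⊗-assoc x _ _))

  pow-* : ∀ m n x → pow (m * n) x ≡ pow m (pow n x)
  pow-* zero    n x = refl
  pow-* (suc m) n x = trans (pow-+ n (m * n) x) (cong (pow n x ⊗_) (pow-* m n x))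

  pow-mono : ∀ n {x y} → x ≤Q y → pow n x ≤Q pow n y
  pow-mono zero    x≤y = ≤-refl
  pow-mono (suc n) x≤y = ⊗-mono x≤y (pow-mono n x≤y)

  ⨁-indicator-≤ : ∀ {I J : Set} (x α : I → Q) (π : J → I) →
                  (∀ c → (α c ≡ ⊥Q) ⊎ (α c ≡ e)) →
                  (∀ c → α c ≡ e → ∃ λ j → π j ≡ c) →
                  ∀ {y} → (∀ j → x (π j) ≤Q y) → ⨁ (λ c → x c ⊗ α c) ≤Q y
  ⨁-indicator-≤ x α π α-01 support {y} bound = ⨁-least _ y λ c → term c (α-01 c)
    where
    term : ∀ c → (α c ≡ ⊥Q) ⊎ (α c ≡ e) → x c ⊗ α c ≤Q y
    term c (inj₁ α≡⊥) =
      ≤-trans (≤-reflexive (trans (cong (x c ⊗_) α≡⊥) (⊥-absorbʳ (x c)))) (⊥-least y)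
    term c (inj₂ α≡e) with support c α≡e
    ... | j , refl = ≤-trans (≤-reflexive (trans (cong (x (π j) ⊗_) α≡e) (⊗-idʳ _))) (bound j)

  module _ (sel : Selective D) where

    ≤-total : ∀ a b → (a ≤Q b) ⊎ (b ≤Q a)
    ≤-total a b with sel a b
    ... | inj₁ a⊕b≡a = inj₂ (a , trans (⊕-comm b a) a⊕b≡a)
    ... | inj₂ a⊕b≡b = inj₁ (b , a⊕b≡b)

    argmax : ∀ {n} (g : Fin (suc n) → Q) → ∃ λ m → ∀ i → g i ≤Q g m
    argmax {zero}  g = fzero , λ { fzero → ≤-refl }
    argmax {suc n} g with argmax (λ i → g (fsuc i))
    ... | m , g≤ with ≤-total (g fzero) (g (fsuc m))
    ... | inj₁ g₀≤ = fsuc m , λ { fzero → g₀≤ ; (fsuc i) → g≤ i }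
    ... | inj₂ ≤g₀ = fzero , λ { fzero → ≤-refl ; (fsuc i) → ≤-trans (g≤ i) ≤g₀ }

    ≤-root : ∀ n {x X} → 1 ≤ n → pow n x ≤Q X → x ≤Q root n X
    ≤-root n {x} {X} n≥1 xⁿ≤X with ≤-total x (root n X)
    ... | inj₁ x≤root = x≤root
    ... | inj₂ root≤x = ≤-reflexive (root-unique n x X n≥1 (≤-antisym _ _ xⁿ≤X X≤xⁿ))
      where
      X≤xⁿ : X ≤Q pow n x
      X≤xⁿ = ≤-trans (≤-reflexive (sym (root-pow n X n≥1))) (pow-mono n root≤x)

    root-≤-root-* : ∀ k r {q X} → 1 ≤ k → 1 ≤ r → pow r q ≤Q X → root k q ≤Q root (k * r) X
    root-≤-root-* k r {q} {X} k≥1 r≥1 qʳ≤X = ≤-root (k * r) (ℕ.*-mono-≤ k≥1 r≥1) (begin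
      pow (k * r) (root k q)   ≡⟨ cong (λ n → pow n (root k q)) (ℕ.*-comm k r) ⟩
      pow (r * k) (root k q)   ≡⟨ pow-* r k (root k q) ⟩
      pow r (pow k (root k q)) ≡⟨ cong (pow r) (root-pow k q k≥1) ⟩
      pow r q                  ≲⟨ qʳ≤X ⟩
      X                        ∎)
      where open ≤-Reasoning

  ≤M-reflexive : ∀ {I J : Set} {A B : Mat I J} → A ≡ B → A ≤M B
  ≤M-reflexive refl i j = ≤-refl

  ≤M-trans : ∀ {I J : Set} {A B C : Mat I J} → A ≤M B → B ≤M C → A ≤M C
  ≤M-trans A≤B B≤C i j = ≤-trans (A≤B i j) (B≤C i j)

  ≤M-preorder : (I J : Set) → Preorder _ _ _
  ≤M-preorder I J = record
    { isPreorder = record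
      { isEquivalence = isEquivalence ; reflexive = ≤M-reflexive ; trans = ≤M-trans {I} {J} } }

  module ≤M-Reasoning {I J : Set} = PreorderReasoning (≤M-preorder I J)

  ⊗M-monoˡ : ∀ {I J K : Set} {A B : Mat I K} (C : Mat K J) → A ≤M B → (A ⊗M C) ≤M (B ⊗M C)
  ⊗M-monoˡ C A≤B i j = ⨁-mono (λ k → ⊗-monoˡ (C k j) (A≤B i k))

  ⊗M-monoʳ : ∀ {I J K : Set} (A : Mat I K) {B C : Mat K J} → B ≤M C → (A ⊗M B) ≤M (A ⊗M C)
  ⊗M-monoʳ A B≤C i j = ⨁-mono (λ k → ⊗-monoʳ (A i k) (B≤C k j))

  ⊗M-assoc-≤ : ∀ {I J K L : Set} (A : Mat I K) (B : Mat K L) (C : Mat L J) →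
               (A ⊗M (B ⊗M C)) ≤M ((A ⊗M B) ⊗M C)
  ⊗M-assoc-≤ A B C i j = ⨁-least _ _ λ k → begin
    A i k ⊗ ⨁ (λ l → B k l ⊗ C l j)   ≡⟨ ⨁-distrib (A i k) _ ⟩
    ⨁ (λ l → A i k ⊗ (B k l ⊗ C l j)) ≲⟨ ⨁-least _ _ (term k) ⟩
    ((A ⊗M B) ⊗M C) i j                ∎
    where
    open ≤-Reasoning
    term : ∀ k l → A i k ⊗ (B k l ⊗ C l j) ≤Q ((A ⊗M B) ⊗M C) i j
    term k l = begin
      A i k ⊗ (B k l ⊗ C l j) ≡⟨ ⊗-assoc (A i k) (B k l) (C l j) ⟨
      (A i k ⊗ B k l) ⊗ C l j ≲⟨ ⊗-monoˡ (C l j) (⨁-upper (λ k′ → A i k′ ⊗ B k′ l) k) ⟩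
      (A ⊗M B) i l ⊗ C l j    ≲⟨ ⨁-upper (λ l′ → (A ⊗M B) i l′ ⊗ C l′ j) l ⟩
      ((A ⊗M B) ⊗M C) i j     ∎

  ⊗M-assoc-≥ : ∀ {I J K L : Set} (A : Mat I K) (B : Mat K L) (C : Mat L J) →
               ((A ⊗M B) ⊗M C) ≤M (A ⊗M (B ⊗M C))
  ⊗M-assoc-≥ A B C i j = ⨁-least _ _ λ l → begin
    ⨁ (λ k → A i k ⊗ B k l) ⊗ C l j   ≲⟨ ⨁-distribʳ-≤ _ (C l j) ⟩
    ⨁ (λ k → (A i k ⊗ B k l) ⊗ C l j) ≲⟨ ⨁-least _ _ (λ k → term k l) ⟩
    (A ⊗M (B ⊗M C)) i j                ∎
    where
    open ≤-Reasoning
    term : ∀ k l → (A i k ⊗ B k l) ⊗ C l j ≤Q (A ⊗M (B ⊗M C)) i j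
    term k l = begin
      (A i k ⊗ B k l) ⊗ C l j ≡⟨ ⊗-assoc (A i k) (B k l) (C l j) ⟩
      A i k ⊗ (B k l ⊗ C l j) ≲⟨ ⊗-monoʳ (A i k) (⨁-upper (λ l′ → B k l′ ⊗ C l′ j) l) ⟩
      A i k ⊗ (B ⊗M C) k j    ≲⟨ ⨁-upper (λ k′ → A i k′ ⊗ (B ⊗M C) k′ j) k ⟩
      (A ⊗M (B ⊗M C)) i j     ∎

  module _ {I : Set} (C : Countable I) where

    idM-diag : ∀ i → idM C i i ≡ e
    idM-diag i with countable-dec C i i
    ... | yes _  = refl
    ... | no i≢i = ⊥-elim (i≢i refl)

    idM-⊗-≤ : ∀ i j {x y} → (i ≡ j → x ≤Q y) → idM C i j ⊗ x ≤Q y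
    idM-⊗-≤ i j {x} {y} x≤y with countable-dec C i j
    ... | yes i≡j = ≤-trans (≤-reflexive (⊗-idˡ x)) (x≤y i≡j)
    ... | no _    = ≤-trans (≤-reflexive (⊥-absorbˡ x)) (⊥-least y)

    idM-⊗M-≤ : ∀ {J : Set} (A : Mat I J) → (idM C ⊗M A) ≤M A
    idM-⊗M-≤ A i j = ⨁-least _ _ λ k → idM-⊗-≤ i k λ { refl → ≤-refl }

    ≤-idM-⊗M : ∀ {J : Set} (A : Mat I J) → A ≤M (idM C ⊗M A)
    ≤-idM-⊗M A i j = begin
      A i j               ≡⟨ ⊗-idˡ (A i j) ⟨
      e ⊗ A i j           ≡⟨ cong (_⊗ A i j) (idM-diag i) ⟨
      idM C i i ⊗ A i j   ≲⟨ ⨁-upper (λ k → idM C i k ⊗ A k j) i ⟩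
      (idM C ⊗M A) i j    ∎
      where open ≤-Reasoning

    ⊗M-idM-≤ : ∀ {J : Set} (A : Mat J I) → (A ⊗M idM C) ≤M A
    ⊗M-idM-≤ A i j = ⨁-least _ _ λ k →
      ≤-trans (≤-reflexive (⊗-comm (A i k) _)) (idM-⊗-≤ k j λ { refl → ≤-refl })

    powM-+ : ∀ (P : Mat I I) m n → (powM C m P ⊗M powM C n P) ≤M powM C (m + n) P
    powM-+ P zero    n = idM-⊗M-≤ (powM C n P)
    powM-+ P (suc m) n = begin
      (P ⊗M powM C m P) ⊗M powM C n P ≲⟨ ⊗M-assoc-≥ P _ _ ⟩
      P ⊗M (powM C m P ⊗M powM C n P) ≲⟨ ⊗M-monoʳ P (powM-+ P m n) ⟩
      P ⊗M powM C (m + n) P           ∎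
      where open ≤M-Reasoning

    walk-≤-powM : ∀ {J : Set} (P : Mat I I) (π : J → I) (f : J → J) k {q} →
                  (∀ j → q ≤Q powM C k P (π j) (π (f j))) →
                  ∀ r j → pow r q ≤Q powM C (r * k) P (π j) (π (iterate f j r))
    walk-≤-powM P π f k step zero    j = ≤-reflexive (sym (idM-diag (π j)))
    walk-≤-powM P π f k {q} step (suc r) j = begin
      q ⊗ pow r q
        ≲⟨ ⊗-mono (step j) (walk-≤-powM P π f k step r (f j)) ⟩
      powM C k P (π j) (π (f j)) ⊗ powM C (r * k) P (π (f j)) (π end)
        ≲⟨ ⨁-upper (λ i → powM C k P (π j) i ⊗ powM C (r * k) P i (π end)) (π (f j)) ⟩
      (powM C k P ⊗M powM C (r * k) P) (π j) (π end)
        ≲⟨ powM-+ P k (r * k) (π j) (π end) ⟩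
      powM C (k + r * k) P (π j) (π end) ∎
      where
      open ≤-Reasoning
      end = iterate f (f j) r

    cycle-≤-powM : ∀ {J : Set} (P : Mat I I) (π : J → I) (f : J → J) k {q} →
                   (∀ j → q ≤Q powM C k P (π j) (π (f j))) →
                   ∀ r j → iterate f j r ≡ j → pow r q ≤Q powM C (k * r) P (π j) (π j)
    cycle-≤-powM P π f k {q} step r j cycle =
      subst (λ n → pow r q ≤Q powM C n P (π j) (π j)) (ℕ.*-comm r k)
        (subst (λ j′ → pow r q ≤Q powM C (r * k) P (π j) (π j′)) cycle
          (walk-≤-powM P π f k step r j))

  simulation-powM : ∀ {I J : Set} (CI : Countable I) (CJ : Countable J)
                    {M : Mat I I} {M♯ : Mat J J} {α : Mat J I} → (α ⊗M M) ≤M (M♯ ⊗M α) →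
                    ∀ n → (α ⊗M powM CI n M) ≤M (powM CJ n M♯ ⊗M α)
  simulation-powM CI CJ {α = α} sim zero = ≤M-trans (⊗M-idM-≤ CI α) (≤-idM-⊗M CJ α)
  simulation-powM CI CJ {M} {M♯} {α} sim (suc n) = begin
    α ⊗M (M ⊗M powM CI n M)   ≲⟨ ⊗M-assoc-≤ α M _ ⟩
    (α ⊗M M) ⊗M powM CI n M   ≲⟨ ⊗M-monoˡ _ sim ⟩
    (M♯ ⊗M α) ⊗M powM CI n M  ≲⟨ ⊗M-assoc-≥ M♯ α _ ⟩
    M♯ ⊗M (α ⊗M powM CI n M)  ≲⟨ ⊗M-monoʳ M♯ (simulation-powM CI CJ sim n) ⟩
    M♯ ⊗M (powM CJ n M♯ ⊗M α) ≲⟨ ⊗M-assoc-≤ M♯ _ α ⟩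
    (M♯ ⊗M powM CJ n M♯) ⊗M α ∎
    where open ≤M-Reasoning

lemma4 : (D : CostDioid) → Selective D →
    let open CostDioid D in
    let open Matrices D in
    {b ba : Set} (Cb : Countable b) (Cba : Countable ba)
    (M : Mat b b) (M♯ : Mat ba ba) (α₁ : Mat ba b) →
    (∀ a i → (α₁ a i ≡ ⊥Q) ⊎ (α₁ a i ≡ e)) →
    (α₁ ⊗M M) ≤M (M♯ ⊗M α₁) →
    (σ : b) (k : ℕ) → 1 ≤ k → ¬ (powM Cb k M σ σ ≡ ⊥Q) →
    (s : ℕ) → 1 ≤ s → (σ♯ : Fin s → ba) → Injective _≡_ _≡_ σ♯ →
    (∀ a → (α₁ a σ ≡ e) → ∃ λ j → σ♯ j ≡ a) →
    (∀ j → α₁ (σ♯ j) σ ≡ e) →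
    ∃ λ (j : Fin s) → ∃ λ (r : ℕ) → 1 ≤ r × r ≤ s ×
    (root k (powM Cb k M σ σ) ≤Q root (k * r) (powM Cba (k * r) M♯ (σ♯ j) (σ♯ j)))
lemma4 D sel Cb Cba M M♯ α₁ α₁-01 sim σ k k≥1 _ (suc s) _ σ♯ _ support onσ =
  let (j , r , r≥1 , r≤s , cycle) = periodic-point best in
  j , r , r≥1 , r≤s ,
  root-≤-root-* sel k r k≥1 r≥1 (cycle-≤-powM Cba M♯ σ♯ best k q≤best r j cycle)
  where
  open CostDioid D
  open Matrices D
  open CostDioidProperties D

  q : Q
  q = powM Cb k M σ σ

  best : Fin (suc s) → Fin (suc s)
  best j = proj₁ (argmax sel (λ j′ → powM Cba k M♯ (σ♯ j) (σ♯ j′)))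

  q≤best : ∀ j → q ≤Q powM Cba k M♯ (σ♯ j) (σ♯ (best j))
  q≤best j = begin
    q                                  ≡⟨ ⊗-idˡ q ⟨
    e ⊗ q                              ≡⟨ cong (_⊗ q) (onσ j) ⟨
    α₁ (σ♯ j) σ ⊗ q                    ≲⟨ ⨁-upper (λ i → α₁ (σ♯ j) i ⊗ powM Cb k M i σ) σ ⟩
    (α₁ ⊗M powM Cb k M) (σ♯ j) σ       ≲⟨ simulation-powM Cb Cba sim k (σ♯ j) σ ⟩
    (powM Cba k M♯ ⊗M α₁) (σ♯ j) σ     ≲⟨ ⨁-indicator-≤ _ (λ c → α₁ c σ) σ♯ (λ c → α₁-01 c σ)
                                              support (proj₂ (argmax sel _)) ⟩
    powM Cba k M♯ (σ♯ j) (σ♯ (best j)) ∎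
    where open ≤-Reasoning
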